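{- Let $k \ge 4$, $p \ge 1$, $\tau \ge 3$ be integers and let $H$ be a $(k-1,\tau)$-Ramsey graph. Then there exists a connected $k$-claw-free graph $G$ on $\Theta(p\,|V(H)|)$ vertices such that $p \le \alpha(G) \le 3pk$ and $\omega(G) \le 3\tau$.
   Context: For $s\ge 3$, $R(s,t)$ is the Ramsey number: the least $N$ such that every graph on $N$ vertices has an independent set of size $s$ or a clique of size $t$. An $(s,t)$-Ramsey graph is a graph on $\lceil R(s,t)-1\rceil$ vertices that has neither an independent set of size $s$ nor a clique of size $t$. A graph is $k$-claw-free if it contains no induced $K_{1,k}$. $\alpha(G)$ and $\omega(G)$ are the independence and clique numbers. The $\Theta$ hides absolute constants. -}

module Defs where

open import Data.Nat using (ℕ; zero; suc; _<_)
open import Data.Fin using (Fin)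
open import Data.Bool using (Bool; true; false)
open import Data.Product using (Σ; _×_)
open import Relation.Binary.PropositionalEquality using (_≡_)
open import Relation.Nullary using (¬_)
open import Function.Definitions using (Injective)

record Graph (n : ℕ) : Set where
  field
    adj   : Fin n → Fin n → Bool
    sym   : ∀ u v → adj u v ≡ adj v u
    irrefl : ∀ v → adj v v ≡ false
open Graph public

Adj : ∀ {n} → Graph n → Fin n → Fin n → Set
Adj G u v = adj G u v ≡ true

NonAdj : ∀ {n} → Graph n → Fin n → Fin n → Set
NonAdj G u v = adj G u v ≡ false

HasIndSet : ∀ {n} → Graph n → ℕ → Set
HasIndSet {n} G s = Σ (Fin s → Fin n) λ f → Injective _≡_ _≡_ f × (∀ i j → ¬ i ≡ j → NonAdj G (f i) (f j))

HasClique : ∀ {n} → Graph n → ℕ → Set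
HasClique {n} G s = Σ (Fin s → Fin n) λ f → Injective _≡_ _≡_ f × (∀ i j → ¬ i ≡ j → Adj G (f i) (f j))

RamseyProperty : ℕ → ℕ → ℕ → Set
RamseyProperty s t N = (G : Graph N) → HasIndSet G s Data.Sum.⊎ HasClique G t
  where import Data.Sum

IsRamseyNumber : ℕ → ℕ → ℕ → Set
IsRamseyNumber s t N = RamseyProperty s t N × (∀ M → M < N → ¬ RamseyProperty s t M)

IsRamseyGraph : ℕ → ℕ → ∀ {n} → Graph n → Set
IsRamseyGraph s t {n} H = IsRamseyNumber s t (suc n) × ¬ HasIndSet H s × ¬ HasClique H t

data Reachable {n : ℕ} (G : Graph n) : Fin n → Fin n → Set where
  here : ∀ {v} → Reachable G v v
  step : ∀ {u w v} → Adj G u w → Reachable G w v → Reachable G u v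

Connected : ∀ {n} → Graph n → Set
Connected {n} G = ∀ (u v : Fin n) → Reachable G u v

HasInducedClaw : ∀ {n} → Graph n → ℕ → Set
HasInducedClaw {n} G k = Σ (Fin n) λ c → Σ (Fin k → Fin n) λ f →
  Injective _≡_ _≡_ f × (∀ i → Adj G c (f i)) × (∀ i j → ¬ i ≡ j → NonAdj G (f i) (f j))

ClawFree : ℕ → ∀ {n} → Graph n → Set
ClawFree k G = ¬ HasInducedClaw G k

αAtLeast : ∀ {n} → Graph n → ℕ → Set
αAtLeast G m = HasIndSet G m

αAtMost : ∀ {n} → Graph n → ℕ → Set
αAtMost G m = ¬ HasIndSet G (suc m)

ωAtMost : ∀ {n} → Graph n → ℕ → Set
ωAtMost G m = ¬ HasClique G (suc m)

module Submission where

-- G is a chain of p blocks: block i is a copy of H together with two adjacent hubs, entry i and exit i,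
-- each joined to the whole copy, and exit i is joined to entry (i + 1). It has p (|V(H)| + 2) vertices,
-- within a factor 3 of p |V(H)| since a Ramsey graph is nonempty. The entries are independent, and
-- every vertex reaches entry 0 through the links, so G is connected.
-- By pigeonhole an independent set of size p (k - 1) + 1 has k vertices in one block; the hubs are
-- adjacent to the rest of their block, so these lie in the copy of H, which has no k - 1 independent
-- vertices. A clique of size 3τ + 1 has τ + 1 vertices of one kind (entry, exit or copy); two entries
-- or two exits are never adjacent, so they are copy vertices, adjacent only within one copy of H.
-- Outside the copy of H in its block, a vertex c has a neighbour guard c adjacent to that whole copy
-- and at most one other neighbour; hence all but one leaf of an induced k-claw at c lie in the copy
-- and form an independent set of size k - 1 in H.

open import Defs hiding (sym)
open import Data.Nat using (ℕ; zero; suc; _+_; _*_; _∸_; _≤_; _<_; _<?_; s≤s; z≤n; s≤s⁻¹)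
import Data.Nat.Properties as ℕ
open import Data.Nat.Properties
  using ( +-suc; +-cancelˡ-<; +-monoˡ-≤; +-monoʳ-≤; *-monoʳ-≤; *-suc; *-assoc; *-commutativeSemigroup
        ; ≤-refl; ≤-trans; ≤-reflexive; ≤∧≢⇒<; ≮⇒≥; <⇒≱; n≤1+n; m≤n+m; m≤n*m)
open import Algebra.Properties.CommutativeSemigroup *-commutativeSemigroup using (x∙yz≈y∙xz)
open import Data.Fin using (Fin; zero; suc; toℕ; inject≤; punchIn; punchOut; combine; remQuot)
open import Data.Fin.Properties
  using ( _≟_; suc-injective; toℕ-injective; toℕ<n; toℕ-inject₁; inject≤-injective; injective⇒≤; any?
        ; punchIn-injective; punchInᵢ≢i; punchIn-punchOut; remQuot-combine; combine-remQuot)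
open import Data.Fin.Induction using (<-weakInduction)
import Data.Bool as Bool
open import Data.Bool using (Bool; true; false)
open import Data.Bool.Properties using (¬-not)
open import Data.Product using (Σ; _×_; _,_; proj₁; proj₂; uncurry)
open import Data.Sum using (_⊎_; inj₁; inj₂)
open import Data.Empty using (⊥; ⊥-elim)
open import Function using (_∘_; mk⇔)
open import Function.Definitions using (Injective)
open import Level using (0ℓ)
open import Relation.Binary using (Rel; Symmetric)
import Relation.Binary.Definitions as B
open import Relation.Binary.Construct.Closure.ReflexiveTransitive using (Star; ε; _◅_; _◅◅_)
open import Relation.Binary.PropositionalEquality using (_≡_; _≢_; refl; sym; trans; cong; subst; subst₂)
open import Relation.Nullary using (¬_; Dec; does; yes; no; ¬?; contradiction)
open import Relation.Nullary.Decidable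
  using (does-⇔; dec-true; dec-false; decidable-stable; map′; _×-dec_; _⊎-dec_)
open import Relation.Unary using (Pred; ∁)
import Relation.Unary as U

Selection : ∀ {N} → Pred (Fin N) 0ℓ → ℕ → Set
Selection {N} P M = Σ (Fin M → Fin N) λ e → Injective _≡_ _≡_ e × (∀ t → P (e t))

module _ {N} {P : Pred (Fin (suc N)) 0ℓ} where

  selection-shift : ∀ {M} → Selection (P ∘ suc) M → Selection P M
  selection-shift (e , e-inj , Pe) = suc ∘ e , e-inj ∘ suc-injective , Pe

  selection-cons : ∀ {M} → P zero → Selection (P ∘ suc) M → Selection P (suc M)
  selection-cons P0 (e , e-inj , Pe) = e′ , e′-inj , Pe′
    where
    e′ : Fin (suc _) → Fin (suc N)
    e′ zero = zero
    e′ (suc t) = suc (e t)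
    e′-inj : Injective _≡_ _≡_ e′
    e′-inj {zero} {zero} _ = refl
    e′-inj {suc t} {suc t′} eq = cong suc (e-inj (suc-injective eq))
    e′-inj {zero} {suc _} ()
    e′-inj {suc _} {zero} ()
    Pe′ : ∀ t → P (e′ t)
    Pe′ zero = P0
    Pe′ (suc t) = Pe t

partition : ∀ {N} {P : Pred (Fin N) 0ℓ} → U.Decidable P →
  Σ ℕ λ M₁ → Σ ℕ λ M₂ → M₁ + M₂ ≡ N × Selection P M₁ × Selection (∁ P) M₂
partition {zero} {P} P? = 0 , 0 , refl , none P , none (∁ P)
  where
  none : ∀ (Q : Pred (Fin 0) 0ℓ) → Selection Q 0
  none Q = (λ ()) , (λ {}) , (λ ())
partition {suc N} {P} P? with partition (P? ∘ suc) | P? zero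
... | M₁ , M₂ , eq , S₁ , S₂ | yes P0 =
  suc M₁ , M₂ , cong suc eq , selection-cons {P = P} P0 S₁ , selection-shift {P = ∁ P} S₂
... | M₁ , M₂ , eq , S₁ , S₂ | no ¬P0 =
  M₁ , suc M₂ , trans (+-suc M₁ M₂) (cong suc eq) ,
  selection-shift {P = P} S₁ , selection-cons {P = ∁ P} ¬P0 S₂

Monochromatic : ∀ {N} {A : Set} → (Fin N → A) → ℕ → Set
Monochromatic {N} col s =
  Σ (Fin s → Fin N) λ e → Injective _≡_ _≡_ e × (∀ t t′ → col (e t) ≡ col (e t′))

-- Either colour c already has b + 1 elements, or the other colours, all below c, cover more than c * b.
pigeonhole-ℕ : ∀ c b {N} (col : Fin N → ℕ) → (∀ x → col x < c) → c * b < N →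
  Monochromatic col (suc b)
pigeonhole-ℕ zero b {suc N} col col<0 _ with () ← col<0 zero
pigeonhole-ℕ (suc c) b col col< cb<N with partition (λ x → col x ℕ.≟ c)
... | M₁ , M₂ , refl , (e₁ , e₁-inj , top) , (e₂ , e₂-inj , ¬top) with b <? M₁
...   | yes b<M₁ =
  (λ t → e₁ (inject≤ t b<M₁)) , e₁-inj-≤ , λ t t′ → trans (top _) (sym (top _))
  where
  e₁-inj-≤ : Injective _≡_ _≡_ (λ t → e₁ (inject≤ t b<M₁))
  e₁-inj-≤ = inject≤-injective b<M₁ b<M₁ _ _ ∘ e₁-inj
...   | no b≮M₁ =
  let e , e-inj , mono = pigeonhole-ℕ c b (col ∘ e₂) col∘e₂<c cb<M₂
  in e₂ ∘ e , e-inj ∘ e₂-inj , mono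
  where
  col∘e₂<c : ∀ t → col (e₂ t) < c
  col∘e₂<c t = ≤∧≢⇒< (s≤s⁻¹ (col< (e₂ t))) (¬top t)
  cb<M₂ : c * b < M₂
  cb<M₂ = +-cancelˡ-< b _ _ (≤-trans cb<N (+-monoˡ-≤ M₂ (≮⇒≥ b≮M₁)))

pigeonhole : ∀ {c N} b (col : Fin N → Fin c) → c * b < N → Monochromatic col (suc b)
pigeonhole {c} b col cb<N =
  let e , e-inj , mono = pigeonhole-ℕ c b (toℕ ∘ col) (toℕ<n ∘ col) cb<N
  in e , e-inj , λ t t′ → toℕ-injective (mono t t′)

selection-all-but-one : ∀ {s} {P : Pred (Fin (suc s)) 0ℓ} → U.Decidable P →
  (∀ t t′ → t ≢ t′ → ¬ P t → ¬ P t′ → ⊥) → Selection P s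
selection-all-but-one P? atMostOneFails with any? (¬? ∘ P?)
... | yes (t₀ , ¬Pt₀) =
  punchIn t₀ , punchIn-injective t₀ _ _ ,
  λ t → decidable-stable (P? _) λ ¬P → atMostOneFails _ t₀ (punchInᵢ≢i t₀ t) ¬P ¬Pt₀
... | no noneFails =
  suc , suc-injective , λ t → decidable-stable (P? _) λ ¬P → noneFails (suc t , ¬P)

avoid-two : ∀ {k} {a b : Fin (suc (suc (suc k)))} → a ≢ b → Σ (Fin (suc (suc (suc k)))) λ c → c ≢ a × c ≢ b
avoid-two {a = a} a≢b =
  punchIn a (punchIn b′ zero) ,
  punchInᵢ≢i a _ ,
  λ c≡b → punchInᵢ≢i b′ zero (punchIn-injective a _ _ (trans c≡b (sym (punchIn-punchOut a≢b))))
  where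
  b′ : Fin (suc (suc _))
  b′ = punchOut a≢b

module FromRelation {n} {E : Rel (Fin n) 0ℓ}
  (E? : B.Decidable E) (E-sym : Symmetric E) (E-irrefl : ∀ v → ¬ E v v) where

  graph : Graph n
  graph = record
    { adj    = λ u v → does (E? u v)
    ; sym    = λ u v → does-⇔ (mk⇔ E-sym E-sym) (E? u v) (E? v u)
    ; irrefl = λ v → dec-false (E? v v) (E-irrefl v)
    }

  Adj⇒E : ∀ {u v} → Adj graph u v → E u v
  Adj⇒E {u} {v} a with E? u v
  ... | yes e = e

  E⇒Adj : ∀ {u v} → E u v → Adj graph u v
  E⇒Adj {u} {v} = dec-true (E? u v)

  NonAdj⇒¬E : ∀ {u v} → NonAdj graph u v → ¬ E u v
  NonAdj⇒¬E {u} {v} na e with () ← trans (sym (E⇒Adj e)) na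

  ¬E⇒NonAdj : ∀ {u v} → ¬ E u v → NonAdj graph u v
  ¬E⇒NonAdj {u} {v} = dec-false (E? u v)

module _ {n} {G : Graph n} where

  Reachable-trans : ∀ {u v w} → Reachable G u v → Reachable G v w → Reachable G u w
  Reachable-trans here q = q
  Reachable-trans (step e p) q = step e (Reachable-trans p q)

  Reachable-sym : ∀ {u v} → Reachable G u v → Reachable G v u
  Reachable-sym here = here
  Reachable-sym (step {u} {w} e p) =
    Reachable-trans (Reachable-sym p) (step (trans (Graph.sym G w u) e) here)

  HasIndSet-≤ : ∀ {s s′} → s ≤ s′ → HasIndSet G s′ → HasIndSet G s
  HasIndSet-≤ s≤s′ (f , f-inj , f-ind) =
    (λ t → f (inject≤ t s≤s′)) ,
    inject≤-injective s≤s′ s≤s′ _ _ ∘ f-inj ,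
    λ t t′ t≢t′ → f-ind _ _ (t≢t′ ∘ inject≤-injective s≤s′ s≤s′ _ _)

  HasClique-≤ : ∀ {s s′} → s ≤ s′ → HasClique G s′ → HasClique G s
  HasClique-≤ s≤s′ (f , f-inj , f-cl) =
    (λ t → f (inject≤ t s≤s′)) ,
    inject≤-injective s≤s′ s≤s′ _ _ ∘ f-inj ,
    λ t t′ t≢t′ → f-cl _ _ (t≢t′ ∘ inject≤-injective s≤s′ s≤s′ _ _)

  αAtMost-mono : ∀ {a b} → a ≤ b → αAtMost G a → αAtMost G b
  αAtMost-mono a≤b α≤a = α≤a ∘ HasIndSet-≤ (s≤s a≤b)

  adjacent-injective : ∀ {s} (f : Fin s → Fin n) → (∀ t t′ → t ≢ t′ → Adj G (f t) (f t′)) →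
    Injective _≡_ _≡_ f
  adjacent-injective f f-adj {t} {t′} eq with t ≟ t′
  ... | yes t≡t′ = t≡t′
  ... | no t≢t′ with () ←
    trans (sym (f-adj t t′ t≢t′)) (trans (cong (adj G (f t)) (sym eq)) (Graph.irrefl G (f t)))

edgeless : ∀ {n} → Graph n
edgeless = record { adj = λ _ _ → false ; sym = λ _ _ → refl ; irrefl = λ _ → refl }

ramseyGraph-nonempty : ∀ {s t m} {H : Graph m} → 2 ≤ s → 2 ≤ t → IsRamseyGraph s t H → 1 ≤ m
ramseyGraph-nonempty {m = suc _} _ _ _ = s≤s z≤n
ramseyGraph-nonempty {m = zero} 2≤s 2≤t ((ramsey , _) , _) with ramsey edgeless
... | inj₁ (f , f-inj , _) = contradiction (injective⇒≤ f-inj) (<⇒≱ 2≤s)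
... | inj₂ (f , f-inj , _) = contradiction (injective⇒≤ f-inj) (<⇒≱ 2≤t)

scale-≤ : ∀ p {x y} → x ≤ y → p * x ≤ 3 * (p * y)
scale-≤ p x≤y = ≤-trans (*-monoʳ-≤ p x≤y) (m≤n*m _ 3)

2+m≤3*m : ∀ {m} → 1 ≤ m → 2 + m ≤ 3 * m
2+m≤3*m {suc m} _ = ≤-trans (+-monoʳ-≤ 3 (m≤n*m m 3)) (≤-reflexive (sym (*-suc 3 m)))

module Chain {m} (H : Graph m) (p : ℕ) where

  Slot : Set
  Slot = Fin (suc (suc m))

  pattern entry  = zero
  pattern exit   = suc zero
  pattern copy u = suc (suc u)

  V : Set
  V = Fin p × Slot

  slotAdj : Slot → Slot → Bool
  slotAdj entry    entry    = false
  slotAdj exit     exit     = false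
  slotAdj (copy u) (copy v) = adj H u v
  slotAdj _        _        = true

  slotAdj-sym : ∀ x y → slotAdj x y ≡ slotAdj y x
  slotAdj-sym entry    entry    = refl
  slotAdj-sym entry    exit     = refl
  slotAdj-sym entry    (copy _) = refl
  slotAdj-sym exit     entry    = refl
  slotAdj-sym exit     exit     = refl
  slotAdj-sym exit     (copy _) = refl
  slotAdj-sym (copy _) entry    = refl
  slotAdj-sym (copy _) exit     = refl
  slotAdj-sym (copy u) (copy v) = Graph.sym H u v

  slotAdj-irrefl : ∀ x → slotAdj x x ≡ false
  slotAdj-irrefl entry    = refl
  slotAdj-irrefl exit     = refl
  slotAdj-irrefl (copy u) = Graph.irrefl H u

  Next : Fin p → Fin p → Set
  Next i j = suc (toℕ i) ≡ toℕ j

  data Edge : V → V → Set where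
    local : ∀ {i x y} → slotAdj x y ≡ true → Edge (i , x) (i , y)
    link  : ∀ {i j} → Next i j → Edge (i , exit) (j , entry)
    link˘ : ∀ {i j} → Next i j → Edge (j , entry) (i , exit)

  edge-sym : ∀ {v w} → Edge v w → Edge w v
  edge-sym (local {x = x} {y} e) = local (trans (slotAdj-sym y x) e)
  edge-sym (link n)  = link˘ n
  edge-sym (link˘ n) = link n

  edge-irrefl : ∀ v → ¬ Edge v v
  edge-irrefl (_ , x) (local e) with () ← trans (sym (slotAdj-irrefl x)) e

  EdgeForm : V → V → Set
  EdgeForm (i , x) (j , y) =
    (i ≡ j × slotAdj x y ≡ true) ⊎
    (x ≡ exit × y ≡ entry × Next i j) ⊎
    (x ≡ entry × y ≡ exit × Next j i)

  form⇒edge : ∀ {v w} → EdgeForm v w → Edge v w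
  form⇒edge (inj₁ (refl , e))               = local e
  form⇒edge (inj₂ (inj₁ (refl , refl , n))) = link n
  form⇒edge (inj₂ (inj₂ (refl , refl , n))) = link˘ n

  edge⇒form : ∀ {v w} → Edge v w → EdgeForm v w
  edge⇒form (local e) = inj₁ (refl , e)
  edge⇒form (link n)  = inj₂ (inj₁ (refl , refl , n))
  edge⇒form (link˘ n) = inj₂ (inj₂ (refl , refl , n))

  edge? : ∀ v w → Dec (Edge v w)
  edge? (i , x) (j , y) = map′ form⇒edge edge⇒form
    ((i ≟ j ×-dec slotAdj x y Bool.≟ true) ⊎-dec
     (x ≟ exit ×-dec y ≟ entry ×-dec suc (toℕ i) ℕ.≟ toℕ j) ⊎-dec
     (x ≟ entry ×-dec y ≟ exit ×-dec suc (toℕ j) ℕ.≟ toℕ i))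

  n : ℕ
  n = p * suc (suc m)

  vertex : Fin n → V
  vertex = remQuot (suc (suc m))

  index : V → Fin n
  index = uncurry combine

  vertex-index : ∀ v → vertex (index v) ≡ v
  vertex-index (i , x) = remQuot-combine i x

  index-vertex : ∀ u → index (vertex u) ≡ u
  index-vertex = combine-remQuot {p} (suc (suc m))

  vertex-injective : Injective _≡_ _≡_ vertex
  vertex-injective {u} {w} eq = trans (sym (index-vertex u)) (trans (cong index eq) (index-vertex w))

  index-injective : Injective _≡_ _≡_ index
  index-injective {v} {w} eq = trans (sym (vertex-index v)) (trans (cong vertex eq) (vertex-index w))

  private
    Edgeᴳ : Fin n → Fin n → Set
    Edgeᴳ u w = Edge (vertex u) (vertex w)

    module FromEdge = FromRelation {E = Edgeᴳ} (λ u w → edge? (vertex u) (vertex w)) edge-sym (edge-irrefl ∘ vertex)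

  G : Graph n
  G = FromEdge.graph

  adjacent-edge : ∀ {v w} → Edge v w → Adj G (index v) (index w)
  adjacent-edge {v} {w} e = FromEdge.E⇒Adj (subst₂ Edge (sym (vertex-index v)) (sym (vertex-index w)) e)

  InCopy : Fin p → V → Set
  InCopy i v = Σ (Fin m) λ u → v ≡ (i , copy u)

  inCopy? : ∀ i v → Dec (InCopy i v)
  inCopy? i (j , entry)  = no λ ()
  inCopy? i (j , exit)   = no λ ()
  inCopy? i (j , copy u) with j ≟ i
  ... | yes refl = yes (u , refl)
  ... | no j≢i   = no λ { (_ , refl) → j≢i refl }

  independent-copies : ∀ {s} i (g : Fin s → V) → Injective _≡_ _≡_ g →
    (∀ t t′ → t ≢ t′ → ¬ Edge (g t) (g t′)) → (∀ t → InCopy i (g t)) → HasIndSet H s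
  independent-copies i g g-inj g-ind g-copy = u , u-inj , u-ind
    where
    u : Fin _ → Fin m
    u = proj₁ ∘ g-copy
    g≡ : ∀ t → g t ≡ (i , copy (u t))
    g≡ = proj₂ ∘ g-copy
    u-inj : Injective _≡_ _≡_ u
    u-inj {t} {t′} eq = g-inj (trans (g≡ t) (trans (cong (λ x → i , copy x) eq) (sym (g≡ t′))))
    u-ind : ∀ t t′ → t ≢ t′ → NonAdj H (u t) (u t′)
    u-ind t t′ t≢t′ = ¬-not λ a → g-ind t t′ t≢t′ (subst₂ Edge (sym (g≡ t)) (sym (g≡ t′)) (local a))

  adjacent-copies : ∀ {s} (g : Fin s → V) → (∀ t t′ → t ≢ t′ → Edge (g t) (g t′)) →
    (∀ t → InCopy (proj₁ (g t)) (g t)) → HasClique H s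
  adjacent-copies g g-adj g-copy = u , adjacent-injective {G = H} u u-adj , u-adj
    where
    u : Fin _ → Fin m
    u = proj₁ ∘ g-copy
    copy-edge⇒adj : ∀ {i j x y} → Edge (i , copy x) (j , copy y) → Adj H x y
    copy-edge⇒adj (local a) = a
    u-adj : ∀ t t′ → t ≢ t′ → Adj H (u t) (u t′)
    u-adj t t′ t≢t′ = copy-edge⇒adj (subst₂ Edge (proj₂ (g-copy t)) (proj₂ (g-copy t′)) (g-adj t t′ t≢t′))

  entries-independent : HasIndSet G p
  entries-independent =
    (λ i → index (i , entry)) ,
    cong proj₁ ∘ index-injective ,
    λ i j _ → FromEdge.¬E⇒NonAdj (entries-nonadjacent ∘ subst₂ Edge (vertex-index _) (vertex-index _))
    where
    entries-nonadjacent : ∀ {i j} → ¬ Edge (i , entry) (j , entry)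
    entries-nonadjacent (local ())

  sameBlock-nonadjacent⇒copy : ∀ {v w} → proj₁ v ≡ proj₁ w → v ≢ w → ¬ Edge v w → InCopy (proj₁ v) v
  sameBlock-nonadjacent⇒copy {_ , copy u}                  _    _   _  = u , refl
  sameBlock-nonadjacent⇒copy {_ , entry} {_ , entry}  refl v≢w _  = ⊥-elim (v≢w refl)
  sameBlock-nonadjacent⇒copy {_ , entry} {_ , exit}   refl _   ¬e = ⊥-elim (¬e (local refl))
  sameBlock-nonadjacent⇒copy {_ , entry} {_ , copy _} refl _   ¬e = ⊥-elim (¬e (local refl))
  sameBlock-nonadjacent⇒copy {_ , exit}  {_ , entry}  refl _   ¬e = ⊥-elim (¬e (local refl))
  sameBlock-nonadjacent⇒copy {_ , exit}  {_ , exit}   refl v≢w _  = ⊥-elim (v≢w refl)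
  sameBlock-nonadjacent⇒copy {_ , exit}  {_ , copy _} refl _   ¬e = ⊥-elim (¬e (local refl))

  α-bound : ∀ {s} → ¬ HasIndSet H s → αAtMost G (p * s)
  α-bound {zero}  noInd _ = noInd ((λ ()) , (λ {}) , λ ())
  α-bound {suc s} noInd (f , f-inj , f-ind) with pigeonhole (suc s) (proj₁ ∘ vertex ∘ f) ≤-refl
  ... | e , e-inj , sameBlock =
    noInd (HasIndSet-≤ {G = H} (n≤1+n _) (independent-copies (proj₁ (g zero)) g g-inj g-ind g-copy))
    where
    g : Fin (suc (suc s)) → V
    g = vertex ∘ f ∘ e
    g-inj : Injective _≡_ _≡_ g
    g-inj = e-inj ∘ f-inj ∘ vertex-injective
    g-ind : ∀ t t′ → t ≢ t′ → ¬ Edge (g t) (g t′)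
    g-ind t t′ t≢t′ = FromEdge.NonAdj⇒¬E (f-ind _ _ (t≢t′ ∘ e-inj))
    g-copy : ∀ t → InCopy (proj₁ (g zero)) (g t)
    g-copy t = subst (λ i → InCopy i (g t)) (sameBlock t zero)
      (sameBlock-nonadjacent⇒copy (sameBlock t (punchIn t zero))
        (punchInᵢ≢i t zero ∘ sym ∘ g-inj) (g-ind t _ (punchInᵢ≢i t zero ∘ sym)))

  kind : Slot → Fin 3
  kind entry    = zero
  kind exit     = suc zero
  kind (copy _) = suc (suc zero)

  sameKind-adjacent⇒copy : ∀ {v w} → kind (proj₂ v) ≡ kind (proj₂ w) → Edge v w → InCopy (proj₁ v) v
  sameKind-adjacent⇒copy {_ , copy u}                _  _         = u , refl
  sameKind-adjacent⇒copy {_ , entry} {_ , entry}     _  (local ())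
  sameKind-adjacent⇒copy {_ , exit}  {_ , exit}      _  (local ())
  sameKind-adjacent⇒copy {_ , entry} {_ , exit}      () _
  sameKind-adjacent⇒copy {_ , entry} {_ , copy _}    () _
  sameKind-adjacent⇒copy {_ , exit}  {_ , entry}     () _
  sameKind-adjacent⇒copy {_ , exit}  {_ , copy _}    () _

  ω-bound : ∀ {τ} → ¬ HasClique H τ → ωAtMost G (3 * τ)
  ω-bound {zero}  noCl _ = noCl ((λ ()) , (λ {}) , λ ())
  ω-bound {suc τ} noCl (f , f-inj , f-cl) with pigeonhole (suc τ) (kind ∘ proj₂ ∘ vertex ∘ f) ≤-refl
  ... | e , e-inj , sameKind = noCl (HasClique-≤ {G = H} (n≤1+n _) (adjacent-copies g g-adj g-copy))
    where
    g : Fin (suc (suc τ)) → V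
    g = vertex ∘ f ∘ e
    g-adj : ∀ t t′ → t ≢ t′ → Edge (g t) (g t′)
    g-adj t t′ t≢t′ = FromEdge.Adj⇒E (f-cl _ _ (t≢t′ ∘ e-inj))
    g-copy : ∀ t → InCopy (proj₁ (g t)) (g t)
    g-copy t = sameKind-adjacent⇒copy (sameKind t (punchIn t zero)) (g-adj t _ (punchInᵢ≢i t zero ∘ sym))

  guard : V → V
  guard (i , entry)  = i , exit
  guard (i , exit)   = i , entry
  guard (i , copy _) = i , entry

  IsSpare : V → V → Set
  IsSpare (j , entry)  w = Σ (Fin p) λ i → Next i j × w ≡ (i , exit)
  IsSpare (i , exit)   w = Σ (Fin p) λ j → Next i j × w ≡ (j , entry)
  IsSpare (i , copy _) w = w ≡ (i , exit)

  spare-unique : ∀ {c w w′} → IsSpare c w → IsSpare c w′ → w ≡ w′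
  spare-unique {_ , entry}  (_ , n , refl) (_ , n′ , refl) =
    cong (_, exit) (toℕ-injective (ℕ.suc-injective (trans n (sym n′))))
  spare-unique {_ , exit}   (_ , n , refl) (_ , n′ , refl) =
    cong (_, entry) (toℕ-injective (trans (sym n) n′))
  spare-unique {_ , copy _} refl refl = refl

  neighbour-cases : ∀ {c w} → Edge c w → InCopy (proj₁ c) w ⊎ w ≡ guard c ⊎ IsSpare c w
  neighbour-cases {_ , entry}  {_ , entry}  (local ())
  neighbour-cases {_ , entry}  {_ , exit}   (local _) = inj₂ (inj₁ refl)
  neighbour-cases {_ , entry}  {_ , copy u} (local _) = inj₁ (u , refl)
  neighbour-cases {_ , entry}  (link˘ n)              = inj₂ (inj₂ (_ , n , refl))
  neighbour-cases {_ , exit}   {_ , entry}  (local _) = inj₂ (inj₁ refl)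
  neighbour-cases {_ , exit}   {_ , exit}   (local ())
  neighbour-cases {_ , exit}   {_ , copy u} (local _) = inj₁ (u , refl)
  neighbour-cases {_ , exit}   (link n)               = inj₂ (inj₂ (_ , n , refl))
  neighbour-cases {_ , copy _} {_ , entry}  (local _) = inj₂ (inj₁ refl)
  neighbour-cases {_ , copy _} {_ , exit}   (local _) = inj₂ (inj₂ refl)
  neighbour-cases {_ , copy _} {_ , copy u} (local _) = inj₁ (u , refl)

  copy-guard : ∀ {c w} → InCopy (proj₁ c) w → Edge w (guard c)
  copy-guard {_ , entry}  (_ , refl) = local refl
  copy-guard {_ , exit}   (_ , refl) = local refl
  copy-guard {_ , copy _} (_ , refl) = local refl

  -- Two leaves outside the copy would be guard c and the spare neighbour, and a third leaf is
  -- adjacent to guard c or equal to one of them.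
  no-claw : ∀ {s} → ¬ HasIndSet H (suc (suc s)) → ∀ c (ℓ : Fin (suc (suc (suc s))) → V) →
    Injective _≡_ _≡_ ℓ → (∀ t → Edge c (ℓ t)) → (∀ t t′ → t ≢ t′ → ¬ Edge (ℓ t) (ℓ t′)) → ⊥
  no-claw noInd c ℓ ℓ-inj ℓ-adj ℓ-ind =
    let e , e-inj , inside = selection-all-but-one (inCopy? (proj₁ c) ∘ ℓ) atMostOneOutside
    in noInd (independent-copies (proj₁ c) (ℓ ∘ e) (e-inj ∘ ℓ-inj)
                (λ t t′ t≢t′ → ℓ-ind _ _ (t≢t′ ∘ e-inj)) inside)
    where
    outside-cases : ∀ t → ¬ InCopy (proj₁ c) (ℓ t) → ℓ t ≡ guard c ⊎ IsSpare c (ℓ t)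
    outside-cases t out with neighbour-cases (ℓ-adj t)
    ... | inj₁ inside = ⊥-elim (out inside)
    ... | inj₂ r      = r
    guard-and-spare : ∀ tg ts → tg ≢ ts → ℓ tg ≡ guard c → IsSpare c (ℓ ts) → ⊥
    guard-and-spare tg ts tg≢ts g s with avoid-two tg≢ts
    ... | t , t≢tg , t≢ts with neighbour-cases (ℓ-adj t)
    ...   | inj₁ inside    = ℓ-ind t tg t≢tg (subst (Edge (ℓ t)) (sym g) (copy-guard inside))
    ...   | inj₂ (inj₁ g′) = t≢tg (ℓ-inj (trans g′ (sym g)))
    ...   | inj₂ (inj₂ s′) = t≢ts (ℓ-inj (spare-unique s′ s))
    atMostOneOutside : ∀ t t′ → t ≢ t′ → ¬ InCopy (proj₁ c) (ℓ t) → ¬ InCopy (proj₁ c) (ℓ t′) → ⊥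
    atMostOneOutside t t′ t≢t′ out out′ with outside-cases t out | outside-cases t′ out′
    ... | inj₁ g | inj₁ g′ = t≢t′ (ℓ-inj (trans g (sym g′)))
    ... | inj₂ s | inj₂ s′ = t≢t′ (ℓ-inj (spare-unique s s′))
    ... | inj₁ g | inj₂ s′ = guard-and-spare t t′ t≢t′ g s′
    ... | inj₂ s | inj₁ g′ = guard-and-spare t′ t (t≢t′ ∘ sym) g′ s

  claw-free : ∀ {s} → ¬ HasIndSet H (suc (suc s)) → ClawFree (suc (suc (suc s))) G
  claw-free noInd (c , f , f-inj , f-adj , f-ind) =
    no-claw noInd (vertex c) (vertex ∘ f) (f-inj ∘ vertex-injective) (FromEdge.Adj⇒E ∘ f-adj)
      λ t t′ t≢t′ → FromEdge.NonAdj⇒¬E (f-ind t t′ t≢t′)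

  star⇒reachable : ∀ {v w} → Star Edge v w → Reachable G (index v) (index w)
  star⇒reachable ε        = here
  star⇒reachable (e ◅ es) = step (adjacent-edge e) (star⇒reachable es)

  to-entry : ∀ i x → Star Edge (i , x) (i , entry)
  to-entry i entry    = ε
  to-entry i exit     = local refl ◅ ε
  to-entry i (copy _) = local refl ◅ ε

connected : ∀ {m} (H : Graph m) q → Connected (Chain.G H (suc q))
connected H q u w = Reachable-trans (to-origin u) (Reachable-sym (to-origin w))
  where
  open Chain H (suc q)
  descend : ∀ i → Star Edge (i , entry) (zero , entry)
  descend = <-weakInduction _ ε λ i r → link˘ (cong suc (toℕ-inject₁ i)) ◅ local refl ◅ r
  to-origin : ∀ u → Reachable G u (index (zero , entry))
  to-origin u = subst (λ v → Reachable G v _) (index-vertex u)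
    (star⇒reachable (to-entry (proj₁ (vertex u)) (proj₂ (vertex u)) ◅◅ descend (proj₁ (vertex u))))

lemma1 : Σ ℕ λ C → (k p τ : ℕ) → 4 ≤ k → 1 ≤ p → 3 ≤ τ →
    ∀ {m} (H : Graph m) → IsRamseyGraph (k ∸ 1) τ H →
    Σ ℕ λ n → Σ (Graph n) λ G →
      (p * m ≤ C * n) × (n ≤ C * (p * m)) ×
      Connected G × ClawFree k G ×
      αAtLeast G p × αAtMost G (3 * p * k) × ωAtMost G (3 * τ)
lemma1 = 3 , λ where
  (suc (suc (suc (suc k)))) p@(suc q) τ (s≤s (s≤s (s≤s (s≤s _)))) _ 3≤τ {m} H isRamsey@(_ , noInd , noCl) →
    let open Chain H p
        1≤m : 1 ≤ m
        1≤m = ramseyGraph-nonempty {H = H} (s≤s (s≤s z≤n)) (≤-trans (n≤1+n 2) 3≤τ) isRamsey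
        α≤ : αAtMost G (3 * p * suc (suc (suc (suc k))))
        α≤ = αAtMost-mono {G = G} (≤-trans (scale-≤ p (n≤1+n _)) (≤-reflexive (sym (*-assoc 3 p _))))
               (α-bound noInd)
    in n , G ,
       scale-≤ p (m≤n+m m 2) ,
       ≤-trans (*-monoʳ-≤ p (2+m≤3*m 1≤m)) (≤-reflexive (x∙yz≈y∙xz p 3 m)) ,
       connected H q , claw-free noInd , entries-independent , α≤ , ω-bound {τ} noCl
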